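{- Let $G=(V,E)$ be an undirected graph, $a,b\in V$, and let $N,T$ be positive integers. Assume it is not possible to send $N$ bits (units of flow) from $a$ to $b$ in $T$ rounds. Then there exists a vector $\ell\in\{0,1,2,\dots,T+1\}^V$ such that $\ell_a=0$, $\ell_b=T+1$ and \[\sum_{(u,v)\in E}\max\{|\ell_u-\ell_v|-1,0\}<N.\]
   Context: Sending $N$ units from $a$ to $b$ in $T$ rounds means a flow of value $N$ from $(a,0)$ to $(b,T)$ in the timed graph $G^{(T)}$: the directed graph on $V\times[0,T]$ with unit-capacity edges $((u,i),(v,i+1))$ and $((v,i),(u,i+1))$ for every $(u,v)\in E$ and $0\le i<T$, plus infinite-capacity edges $((u,i),(u,i+1))$ for every $u\in V$. -}

module Defs where

open import Data.Nat using (ℕ; zero; suc; _+_; _∸_; _≤_; _<_; ∣_-_∣; _<ᵇ_)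
open import Data.Fin using (Fin; toℕ)
open import Data.Bool using (Bool; true; false; _∧_; if_then_else_)
open import Data.Product using (_×_; Σ)
open import Relation.Binary.PropositionalEquality using (_≡_; _≢_)

Σ[Fin] : ∀ {n} → (Fin n → ℕ) → ℕ
Σ[Fin] {zero}  f = 0
Σ[Fin] {suc n} f = f Fin.zero + Σ[Fin] {n} (λ i → f (Fin.suc i))

record Graph (n : ℕ) : Set where
  field
    adj   : Fin n → Fin n → Bool
    sym   : ∀ u v → adj u v ≡ adj v u
    irrefl : ∀ u → adj u u ≡ false
open Graph public

-- An (integral) flow in the timed graph G^(T).
--   cross i u v : flow on the unit-capacity edge ((u,i),(v,i+1))  (i < T)
--   stay  i u   : flow on the infinite-capacity edge ((u,i),(u,i+1)) (i < T)
-- Values at times i ≥ T are never used.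
record TimedFlow {n : ℕ} (G : Graph n) (T : ℕ) : Set where
  field
    cross : ℕ → Fin n → Fin n → ℕ
    stay  : ℕ → Fin n → ℕ

  outflow : Fin n → ℕ → ℕ
  outflow w j = stay j w + Σ[Fin] (λ v → cross j w v)

  inflow : Fin n → ℕ → ℕ
  inflow w zero    = 0
  inflow w (suc j) = stay j w + Σ[Fin] (λ u → cross j u w)
open TimedFlow public

record IsFlow {n : ℕ} (G : Graph n) (T : ℕ) (a b : Fin n) (N : ℕ)
              (f : TimedFlow G T) : Set where
  field
    cap-unit  : ∀ i → i < T → ∀ u v → cross f i u v ≤ 1
    cap-nonedge : ∀ i → i < T → ∀ u v → adj G u v ≡ false → cross f i u v ≡ 0
    conserve  : ∀ j → j < T → ∀ w → (j ≡ 0 → w ≢ a) → inflow f w j ≡ outflow f w j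
    -- conservation at nodes (w,T) other than the sink (b,T) (no out-edges)
    conserve-T : ∀ w → w ≢ b → inflow f w T ≡ 0
    -- value: the source (a,0) has no in-edges, net outflow N
    value     : outflow f a 0 ≡ N

CanSend : ∀ {n} → Graph n → Fin n → Fin n → ℕ → ℕ → Set
CanSend G a b N T = Σ (TimedFlow G T) (IsFlow G T a b N)

-- Σ_{{u,v} ∈ E} max{|ℓ_u − ℓ_v| − 1, 0}, each undirected edge counted once
-- (as the ordered pair with u < v).
edgeCost : ∀ {n} → Graph n → (Fin n → ℕ) → ℕ
edgeCost G ℓ = Σ[Fin] (λ u → Σ[Fin] (λ v →
  if adj G u v ∧ (toℕ u <ᵇ toℕ v) then ∣ ℓ u - ℓ v ∣ ∸ 1 else 0))

-- Ford–Fulkerson in the timed graph G^(T). Starting from the zero flow, let S be the set of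
-- timed vertices reachable from (a,0) in the residual graph of the current flow. If (b,T) ∈ S,
-- an augmenting path raises the value by one; as N units cannot be sent, after fewer than N
-- augmentations (b,T) ∉ S. Then S is closed under waiting, hence S = {(w,j) : ℓ_w ≤ j} where
-- ℓ_w ∈ [0,T+1] is the first time w enters S, so ℓ_a = 0 and ℓ_b = T+1. No flow enters S and
-- every unit edge leaving S is saturated, so the current value k < N equals the number of edges
-- ((u,j),(v,j+1)) with ℓ_u ≤ j < ℓ_v − 1, which is Σ_{uv ∈ E} max(|ℓ_u − ℓ_v| − 1, 0).

module Submission where

open import Defs hiding (sym)
open import Data.Nat
  using (ℕ; zero; suc; _+_; _*_; _∸_; _≤_; _<_; z≤n; s≤s; s≤s⁻¹; z<s; s<s; s<s⁻¹; _≤ᵇ_; _<ᵇ_; _≡ᵇ_; ∣_-_∣; _≟_; _≤?_)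
open import Data.Nat.Properties
open import Algebra.Properties.CommutativeMonoid.Sum +-0-commutativeMonoid as ∑
  using (sum)
open import Algebra.Properties.CommutativeSemigroup +-commutativeSemigroup
  using (xy∙z≈xz∙y; xy∙z≈x∙zy)
open import Data.Fin using (Fin; toℕ; fromℕ<)
import Data.Fin.Properties as Finₚ
-- Data.Bool's T is renamed So, as T is the number of rounds.
open import Data.Bool using (Bool; true; false; if_then_else_; _∧_; _∨_) renaming (T to So)
open import Data.Bool.Properties as Boolₚ using (T-∧; T-∨; T-≡)
open import Relation.Nullary.Decidable.Core using (T?)
open import Data.Empty using (⊥-elim)
open import Data.Sum using (_⊎_; inj₁; inj₂)
open import Data.Product using (Σ; ∃; _×_; _,_; proj₁; proj₂)
open import Function using (_∘_)
open import Function.Bundles using (module Equivalence)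
open Equivalence using (to; from)
open import Relation.Nullary using (¬_; Dec; yes; no; does; contradiction; ofʸ; ofⁿ)
open import Relation.Nullary.Decidable using (⌊_⌋; toWitness; fromWitness)
open import Relation.Binary.PropositionalEquality

Σ-cong : ∀ {n} {f g : Fin n → ℕ} → (∀ i → f i ≡ g i) → Σ[Fin] f ≡ Σ[Fin] g
Σ-cong {zero}  e = refl
Σ-cong {suc n} e = cong₂ _+_ (e Fin.zero) (Σ-cong (e ∘ Fin.suc))

Σ≡sum : ∀ {n} (f : Fin n → ℕ) → Σ[Fin] f ≡ sum f
Σ≡sum {zero}  f = refl
Σ≡sum {suc n} f = cong (f Fin.zero +_) (Σ≡sum (f ∘ Fin.suc))

Σ-distrib-+ : ∀ {n} (f g : Fin n → ℕ) → Σ[Fin] (λ i → f i + g i) ≡ Σ[Fin] f + Σ[Fin] g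
Σ-distrib-+ f g = begin
  Σ[Fin] (λ i → f i + g i) ≡⟨ Σ≡sum (λ i → f i + g i) ⟩
  sum (λ i → f i + g i)    ≡⟨ ∑.∑-distrib-+ f g ⟩
  sum f + sum g            ≡⟨ cong₂ _+_ (Σ≡sum f) (Σ≡sum g) ⟨
  Σ[Fin] f + Σ[Fin] g      ∎
  where open ≡-Reasoning

Σ-comm : ∀ {m n} (f : Fin m → Fin n → ℕ) →
  Σ[Fin] (λ i → Σ[Fin] (f i)) ≡ Σ[Fin] (λ j → Σ[Fin] (λ i → f i j))
Σ-comm f = begin
  Σ[Fin] (λ i → Σ[Fin] (f i))
    ≡⟨ trans (Σ-cong (λ i → Σ≡sum (f i))) (Σ≡sum (λ i → sum (f i))) ⟩
  sum (λ i → sum (f i))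
    ≡⟨ ∑.∑-comm f ⟩
  sum (λ j → sum (λ i → f i j))
    ≡⟨ trans (Σ-cong (λ j → Σ≡sum (λ i → f i j))) (Σ≡sum (λ j → sum (λ i → f i j))) ⟨
  Σ[Fin] (λ j → Σ[Fin] (λ i → f i j)) ∎
  where open ≡-Reasoning

Σ-mono-≤ : ∀ {n} {f g : Fin n → ℕ} → (∀ i → f i ≤ g i) → Σ[Fin] f ≤ Σ[Fin] g
Σ-mono-≤ {zero}  le = z≤n
Σ-mono-≤ {suc n} le = +-mono-≤ (le Fin.zero) (Σ-mono-≤ (le ∘ Fin.suc))

Σ-mono-< : ∀ {n} {f g : Fin n → ℕ} (i₀ : Fin n) →
  (∀ i → f i ≤ g i) → f i₀ < g i₀ → Σ[Fin] f < Σ[Fin] g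
Σ-mono-< Fin.zero     le lt = +-mono-<-≤ lt (Σ-mono-≤ (le ∘ Fin.suc))
Σ-mono-< (Fin.suc i₀) le lt = +-mono-≤-< (le Fin.zero) (Σ-mono-< i₀ (le ∘ Fin.suc) lt)

Σ-≤-* : ∀ {n} {f : Fin n → ℕ} (c : ℕ) → (∀ i → f i ≤ c) → Σ[Fin] f ≤ n * c
Σ-≤-* {zero}  c le = z≤n
Σ-≤-* {suc n} c le = +-mono-≤ (le Fin.zero) (Σ-≤-* c (le ∘ Fin.suc))

Σ-zero : ∀ {n} {f : Fin n → ℕ} → (∀ i → f i ≡ 0) → Σ[Fin] f ≡ 0
Σ-zero {zero}  z = refl
Σ-zero {suc n} z = cong₂ _+_ (z Fin.zero) (Σ-zero (z ∘ Fin.suc))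

Σ-point : ∀ {n} (f : Fin n → ℕ) (i₀ : Fin n) → (∀ i → i ≢ i₀ → f i ≡ 0) → Σ[Fin] f ≡ f i₀
Σ-point f Fin.zero     z = trans (cong (f Fin.zero +_) (Σ-zero (λ i → z (Fin.suc i) λ ()))) (+-identityʳ _)
Σ-point f (Fin.suc i₀) z = trans (cong (_+ Σ[Fin] (f ∘ Fin.suc)) (z Fin.zero λ ()))
  (Σ-point (f ∘ Fin.suc) i₀ (λ i i≢i₀ → z (Fin.suc i) (i≢i₀ ∘ Finₚ.suc-injective)))

when : Bool → ℕ → ℕ
when b x = if b then x else 0

when-0 : ∀ b → when b 0 ≡ 0
when-0 true  = refl
when-0 false = refl

when-+ : ∀ b x y → when b (x + y) ≡ when b x + when b y
when-+ true  x y = refl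
when-+ false x y = refl

Σ-when : ∀ {n} b (f : Fin n → ℕ) → Σ[Fin] (λ i → when b (f i)) ≡ when b (Σ[Fin] f)
Σ-when true  f = refl
Σ-when {n} false f = Σ-zero {n} (λ _ → refl)

when-+-Σ : ∀ {n} b x (g : Fin n → ℕ) → when b (x + Σ[Fin] g) ≡ when b x + Σ[Fin] (λ i → when b (g i))
when-+-Σ b x g = trans (when-+ b x (Σ[Fin] g)) (cong (when b x +_) (sym (Σ-when b g)))

ΣΣ-unordered-≤ : ∀ {n} (E D : Fin n → Fin n → ℕ) →
  (∀ u v → E u v ≤ when (toℕ u <ᵇ toℕ v) (D u v + D v u)) →
  Σ[Fin] (λ u → Σ[Fin] (E u)) ≤ Σ[Fin] (λ u → Σ[Fin] (D u))
ΣΣ-unordered-≤ E D E≤ = begin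
  ΣΣ E
    ≤⟨ Σ-mono-≤ (λ u → Σ-mono-≤ (λ v → ≤-trans (E≤ u v) (≤-reflexive (when-+ (u ≺ v) _ _)))) ⟩
  ΣΣ (λ u v → below u v + above′ u v)
    ≡⟨ ΣΣ-distrib-+ below above′ ⟩
  ΣΣ below + ΣΣ above′
    ≡⟨ cong (ΣΣ below +_) (Σ-comm above′) ⟩
  ΣΣ below + ΣΣ above
    ≡⟨ ΣΣ-distrib-+ below above ⟨
  ΣΣ (λ u v → below u v + above u v)
    ≤⟨ Σ-mono-≤ (λ u → Σ-mono-≤ (λ v → split u v)) ⟩
  ΣΣ D ∎
  where
  open ≤-Reasoning
  ΣΣ : (Fin _ → Fin _ → ℕ) → ℕ
  ΣΣ F = Σ[Fin] (λ u → Σ[Fin] (F u))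
  ΣΣ-distrib-+ : ∀ F H → ΣΣ (λ u v → F u v + H u v) ≡ ΣΣ F + ΣΣ H
  ΣΣ-distrib-+ F H = trans (Σ-cong (λ u → Σ-distrib-+ (F u) (H u))) (Σ-distrib-+ (λ u → Σ[Fin] (F u)) (λ u → Σ[Fin] (H u)))
  _≺_ : Fin _ → Fin _ → Bool
  u ≺ v = toℕ u <ᵇ toℕ v
  below above above′ : Fin _ → Fin _ → ℕ
  below  u v = when (u ≺ v) (D u v)
  above  u v = when (v ≺ u) (D u v)
  above′ u v = when (u ≺ v) (D v u)
  split : ∀ u v → below u v + above u v ≤ D u v
  split u v with toℕ u <ᵇ toℕ v in u<v | toℕ v <ᵇ toℕ u in v<u
  ... | true  | true  = contradiction (<ᵇ⇒< (toℕ v) (toℕ u) (from T-≡ v<u)) (<-asym (<ᵇ⇒< (toℕ u) (toℕ v) (from T-≡ u<v)))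
  ... | true  | false = ≤-reflexive (+-identityʳ _)
  ... | false | true  = ≤-refl
  ... | false | false = z≤n

∣-∣∸1-split : ∀ x y → ∣ x - y ∣ ∸ 1 ≡ (y ∸ 1 ∸ x) + (x ∸ 1 ∸ y)
∣-∣∸1-split zero    zero    = refl
∣-∣∸1-split zero    (suc y) = sym (+-identityʳ _)
∣-∣∸1-split (suc x) zero    = refl
∣-∣∸1-split (suc x) (suc y) = trans (∣-∣∸1-split x y) (cong₂ _+_ (∸-+-assoc y 1 x) (∸-+-assoc x 1 y))

telescope : ∀ t (P C : ℕ → ℕ) → (∀ j → j < t → P j ≡ P (suc j) + C j) →
  P 0 ≡ P t + Σ[Fin] {t} (C ∘ toℕ)
telescope zero    P C step = sym (+-identityʳ (P 0))
telescope (suc t) P C step = begin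
  P 0
    ≡⟨ step 0 z<s ⟩
  P 1 + C 0
    ≡⟨ cong (_+ C 0) (telescope t (P ∘ suc) (C ∘ suc) (λ j j<t → step (suc j) (s<s j<t))) ⟩
  P (suc t) + Σ[Fin] {t} (C ∘ suc ∘ toℕ) + C 0
    ≡⟨ xy∙z≈x∙zy (P (suc t)) _ (C 0) ⟩
  P (suc t) + Σ[Fin] {suc t} (C ∘ toℕ) ∎
  where open ≡-Reasoning

≡false⇒¬So : ∀ {x} → x ≡ false → ¬ So x
≡false⇒¬So refl ()

¬So⇒≡false : ∀ {x} → ¬ So x → x ≡ false
¬So⇒≡false {true}  ¬x = contradiction _ ¬x
¬So⇒≡false {false} _  = refl

newly-true : ∀ {x y : Bool} → (So x → So y) → y ≢ x → So y × ¬ So x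
newly-true {false} {true}  _    _   = _ , λ ()
newly-true {true}  {true}  _    y≢x = contradiction refl y≢x
newly-true {false} {false} _    y≢x = contradiction refl y≢x
newly-true {true}  {false} x⇒y  _   = ⊥-elim (x⇒y _)

first : ℕ → (ℕ → Bool) → ℕ
first zero    p = 0
first (suc k) p = if p 0 then 0 else suc (first k (p ∘ suc))

first-≤ : ∀ k p → first k p ≤ k
first-≤ zero    p = z≤n
first-≤ (suc k) p with p 0
... | true  = z≤n
... | false = s≤s (first-≤ k (p ∘ suc))

first-minimal : ∀ k p {j} → j < first k p → ¬ So (p j)
first-minimal (suc k) p {j} j<first with p 0 in p0
first-minimal (suc k) p {zero}  j<first | false = ≡false⇒¬So p0
first-minimal (suc k) p {suc j} j<first | false = first-minimal k (p ∘ suc) (s<s⁻¹ j<first)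

first-found : ∀ k p → first k p < k → So (p (first k p))
first-found (suc k) p first<k with p 0 in p0
... | true  = from T-≡ p0
... | false = first-found k (p ∘ suc) (s<s⁻¹ first<k)

window : ℕ → ℕ → ℕ → ℕ
window x y j = when (x ≤ᵇ j) (if y ≤ᵇ suc j then 0 else 1)

window-suc : ∀ x y j → window x y (suc j) ≡ window (x ∸ 1) (y ∸ 1) j
window-suc x y j = cong₂ (λ p q → when p (if q then 0 else 1)) (≤ᵇ-suc x j) (≤ᵇ-suc y (suc j))
  where
  ≤ᵇ-suc : ∀ x j → (x ≤ᵇ suc j) ≡ (x ∸ 1 ≤ᵇ j)
  ≤ᵇ-suc zero          j = refl
  ≤ᵇ-suc (suc zero)    j = refl
  ≤ᵇ-suc (suc (suc x)) j = refl

Σ-window : ∀ t x y → y ≤ suc t → Σ[Fin] {t} (window x y ∘ toℕ) ≡ y ∸ 1 ∸ x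
Σ-window zero    x zero          _ = sym (0∸n≡0 x)
Σ-window zero    x (suc zero)    _ = sym (0∸n≡0 x)
Σ-window zero    x (suc (suc y)) (s≤s ())
Σ-window (suc t) x y y≤ = begin
  window x y 0 + Σ[Fin] {t} (window x y ∘ suc ∘ toℕ)
    ≡⟨ cong (window x y 0 +_) (Σ-cong {t} (window-suc x y ∘ toℕ)) ⟩
  window x y 0 + Σ[Fin] {t} (window (x ∸ 1) (y ∸ 1) ∘ toℕ)
    ≡⟨ cong (window x y 0 +_) (Σ-window t (x ∸ 1) (y ∸ 1) (∸-monoˡ-≤ 1 y≤)) ⟩
  window x y 0 + (y ∸ 1 ∸ 1 ∸ (x ∸ 1))
    ≡⟨ first-step x y ⟩
  y ∸ 1 ∸ x ∎
  where
  open ≡-Reasoning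
  first-step : ∀ x y → window x y 0 + (y ∸ 1 ∸ 1 ∸ (x ∸ 1)) ≡ y ∸ 1 ∸ x
  first-step zero    zero          = refl
  first-step zero    (suc zero)    = refl
  first-step zero    (suc (suc y)) = refl
  first-step (suc x) y             = ∸-+-assoc (y ∸ 1) 1 x

𝟙[_] : ∀ {p} {P : Set p} → Dec P → ℕ
𝟙[ d ] = if does d then 1 else 0

module _ {p} {P : Set p} where

  𝟙-yes : (d : Dec P) → P → 𝟙[ d ] ≡ 1
  𝟙-yes (yes _) _  = refl
  𝟙-yes (no ¬p) p = contradiction p ¬p

  𝟙-no : (d : Dec P) → ¬ P → 𝟙[ d ] ≡ 0
  𝟙-no (yes p) ¬p = contradiction p ¬p
  𝟙-no (no _)  _  = refl

  𝟙-cases : (d : Dec P) → 𝟙[ d ] ≡ 0 ⊎ P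
  𝟙-cases (yes p) = inj₂ p
  𝟙-cases (no _)  = inj₁ refl

module _ {s t} (R : ℕ → Fin s → Fin t → Bool) (R-mono : ∀ m u j → So (R m u j) → So (R (suc m) u j)) where

  Stable : ℕ → Set
  Stable m = ∀ u j → R (suc m) u j ≡ R m u j

  truthCount : ℕ → ℕ
  truthCount m = Σ[Fin] (λ u → Σ[Fin] (λ j → 𝟙[ T? (R m u j) ]))

  truthCount-≤ : ∀ m → truthCount m ≤ s * t
  truthCount-≤ m = Σ-≤-* t (λ u → ≤-trans (Σ-≤-* 1 (λ j → 𝟙≤1 (R m u j))) (≤-reflexive (*-identityʳ t)))
    where
    𝟙≤1 : ∀ x → 𝟙[ T? x ] ≤ 1
    𝟙≤1 true  = ≤-refl
    𝟙≤1 false = z≤n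

  truthCount-grows : ∀ m → ¬ Stable m → truthCount m < truthCount (suc m)
  truthCount-grows m unstable
    with Finₚ.¬∀⟶∃¬ s _ (λ u → Finₚ.all? (λ j → R (suc m) u j Boolₚ.≟ R m u j)) unstable
  ... | u , ¬u with Finₚ.¬∀⟶∃¬ t _ (λ j → R (suc m) u j Boolₚ.≟ R m u j) ¬u
  ... | j , ¬j with newly-true (R-mono m u j) ¬j
  ... | new , ¬old = Σ-mono-< u (λ u′ → Σ-mono-≤ (λ j′ → 𝟙-mono (R-mono m u′ j′)))
        (Σ-mono-< j (λ j′ → 𝟙-mono (R-mono m u j′)) (𝟙-new new ¬old))
    where
    𝟙-mono : ∀ {x y} → (So x → So y) → 𝟙[ T? x ] ≤ 𝟙[ T? y ]
    𝟙-mono {false} _   = z≤n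
    𝟙-mono {true} {true}  _   = ≤-refl
    𝟙-mono {true} {false} x⇒y = ⊥-elim (x⇒y _)
    𝟙-new : ∀ {x y} → So y → ¬ So x → 𝟙[ T? x ] < 𝟙[ T? y ]
    𝟙-new {false} {true} _ _ = ≤-refl
    𝟙-new {true} _ ¬x = contradiction _ ¬x

  stable? : ∀ m → Dec (Stable m)
  stable? m = Finₚ.all? λ u → Finₚ.all? λ j → R (suc m) u j Boolₚ.≟ R m u j

  stable-or-large : ∀ m → ∃ Stable ⊎ m ≤ truthCount m
  stable-or-large zero = inj₂ z≤n
  stable-or-large (suc m) with stable-or-large m
  ... | inj₁ found   = inj₁ found
  ... | inj₂ m≤truthCount with stable? m
  ... | yes stable   = inj₁ (m , stable)
  ... | no  unstable = inj₂ (≤-trans (s≤s m≤truthCount) (truthCount-grows m unstable))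

  stabilises : ∃ Stable
  stabilises with stable-or-large (suc (s * t))
  ... | inj₁ found = found
  ... | inj₂ large = contradiction (≤-trans large (truthCount-≤ _)) (<-irrefl refl)

-- δ u₀ i₀ is the point mass at the timed vertex (u₀,i₀), and edgeδ i₀ u₀ v₀ the unit flow on the
-- timed edge ((u₀,i₀),(v₀,i₀+1)).
δ : ∀ {n} → Fin n → ℕ → Fin n → ℕ → ℕ
δ u₀ i₀ u i = 𝟙[ u Finₚ.≟ u₀ ] * 𝟙[ i ≟ i₀ ]

δ-at : ∀ {n} (u : Fin n) i → δ u i u i ≡ 1
δ-at u i rewrite 𝟙-yes (u Finₚ.≟ u) refl | 𝟙-yes (i ≟ i) refl = refl

δ-off-vertex : ∀ {n} {u₀ u : Fin n} i₀ i → u ≢ u₀ → δ u₀ i₀ u i ≡ 0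
δ-off-vertex {u₀ = u₀} {u} i₀ i u≢u₀ rewrite 𝟙-no (u Finₚ.≟ u₀) u≢u₀ = refl

δ-off-time : ∀ {n} (u₀ u : Fin n) {i₀ i} → i ≢ i₀ → δ u₀ i₀ u i ≡ 0
δ-off-time u₀ u {i₀} {i} i≢i₀ rewrite 𝟙-no (i ≟ i₀) i≢i₀ = *-zeroʳ 𝟙[ u Finₚ.≟ u₀ ]

δ-cases : ∀ {n} (u₀ : Fin n) i₀ u i → δ u₀ i₀ u i ≡ 0 ⊎ (u ≡ u₀ × i ≡ i₀)
δ-cases u₀ i₀ u i with 𝟙-cases (u Finₚ.≟ u₀) | 𝟙-cases (i ≟ i₀)
... | inj₁ 𝟙≡0 | _ = inj₁ (cong (_* 𝟙[ i ≟ i₀ ]) 𝟙≡0)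
... | inj₂ _ | inj₁ 𝟙≡0 = inj₁ (trans (cong (𝟙[ u Finₚ.≟ u₀ ] *_) 𝟙≡0) (*-zeroʳ 𝟙[ u Finₚ.≟ u₀ ]))
... | inj₂ u≡u₀ | inj₂ i≡i₀ = inj₂ (u≡u₀ , i≡i₀)

edgeδ : ∀ {n} → ℕ → Fin n → Fin n → ℕ → Fin n → Fin n → ℕ
edgeδ i₀ u₀ v₀ i u v = δ u₀ i₀ u i * 𝟙[ v Finₚ.≟ v₀ ]

edgeδ-at : ∀ {n} i (u v : Fin n) → edgeδ i u v i u v ≡ 1
edgeδ-at i u v rewrite δ-at u i | 𝟙-yes (v Finₚ.≟ v) refl = refl

edgeδ-cases : ∀ {n} i₀ (u₀ v₀ : Fin n) i u v →
  edgeδ i₀ u₀ v₀ i u v ≡ 0 ⊎ (i ≡ i₀ × u ≡ u₀ × v ≡ v₀)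
edgeδ-cases i₀ u₀ v₀ i u v with δ-cases u₀ i₀ u i | 𝟙-cases (v Finₚ.≟ v₀)
... | inj₁ δ≡0 | _ = inj₁ (cong (_* 𝟙[ v Finₚ.≟ v₀ ]) δ≡0)
... | inj₂ _ | inj₁ 𝟙≡0 = inj₁ (trans (cong (δ u₀ i₀ u i *_) 𝟙≡0) (*-zeroʳ (δ u₀ i₀ u i)))
... | inj₂ (u≡u₀ , i≡i₀) | inj₂ v≡v₀ = inj₂ (i≡i₀ , u≡u₀ , v≡v₀)

Σ-edgeδ-head : ∀ {n} i₀ (u₀ v₀ : Fin n) i u → Σ[Fin] (edgeδ i₀ u₀ v₀ i u) ≡ δ u₀ i₀ u i
Σ-edgeδ-head i₀ u₀ v₀ i u = begin
  Σ[Fin] (edgeδ i₀ u₀ v₀ i u)            ≡⟨ Σ-point _ v₀ off ⟩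
  δ u₀ i₀ u i * 𝟙[ v₀ Finₚ.≟ v₀ ]        ≡⟨ cong (δ u₀ i₀ u i *_) (𝟙-yes (v₀ Finₚ.≟ v₀) refl) ⟩
  δ u₀ i₀ u i * 1                        ≡⟨ *-identityʳ _ ⟩
  δ u₀ i₀ u i                            ∎
  where
  open ≡-Reasoning
  off : ∀ v → v ≢ v₀ → edgeδ i₀ u₀ v₀ i u v ≡ 0
  off v v≢v₀ = trans (cong (δ u₀ i₀ u i *_) (𝟙-no (v Finₚ.≟ v₀) v≢v₀)) (*-zeroʳ (δ u₀ i₀ u i))

Σ-edgeδ-tail : ∀ {n} i₀ (u₀ v₀ : Fin n) i v →
  Σ[Fin] (λ u → edgeδ i₀ u₀ v₀ i u v) ≡ δ v₀ (suc i₀) v (suc i)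
Σ-edgeδ-tail i₀ u₀ v₀ i v = begin
  Σ[Fin] (λ u → edgeδ i₀ u₀ v₀ i u v)
    ≡⟨ Σ-point _ u₀ off ⟩
  𝟙[ u₀ Finₚ.≟ u₀ ] * 𝟙[ i ≟ i₀ ] * 𝟙[ v Finₚ.≟ v₀ ]
    ≡⟨ cong (λ x → x * 𝟙[ i ≟ i₀ ] * 𝟙[ v Finₚ.≟ v₀ ]) (𝟙-yes (u₀ Finₚ.≟ u₀) refl) ⟩
  1 * 𝟙[ i ≟ i₀ ] * 𝟙[ v Finₚ.≟ v₀ ]
    ≡⟨ cong (_* 𝟙[ v Finₚ.≟ v₀ ]) (*-identityˡ 𝟙[ i ≟ i₀ ]) ⟩
  𝟙[ i ≟ i₀ ] * 𝟙[ v Finₚ.≟ v₀ ]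
    ≡⟨ *-comm 𝟙[ i ≟ i₀ ] _ ⟩
  δ v₀ (suc i₀) v (suc i) ∎
  where
  open ≡-Reasoning
  off : ∀ u → u ≢ u₀ → edgeδ i₀ u₀ v₀ i u v ≡ 0
  off u u≢u₀ = cong (_* 𝟙[ v Finₚ.≟ v₀ ]) (δ-off-vertex i₀ i u≢u₀)

module _ {n} (S : Fin n → ℕ → Bool) where

  edgeδ-outside : ∀ {i₀ u₀ v₀} → ¬ (So (S u₀ i₀) × So (S v₀ (suc i₀))) →
    ∀ i u v → So (S u i) → So (S v (suc i)) → edgeδ i₀ u₀ v₀ i u v ≡ 0
  edgeδ-outside {i₀} {u₀} {v₀} outside i u v su sv with edgeδ-cases i₀ u₀ v₀ i u v
  ... | inj₁ edgeδ≡0 = edgeδ≡0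
  ... | inj₂ (refl , refl , refl) = contradiction (su , sv) outside

  δ-outside : ∀ {i₀ u₀} → ¬ (So (S u₀ i₀) × So (S u₀ (suc i₀))) →
    ∀ i u → So (S u i) → So (S u (suc i)) → δ u₀ i₀ u i ≡ 0
  δ-outside {i₀} {u₀} outside i u su su′ with δ-cases u₀ i₀ u i
  ... | inj₁ δ≡0 = δ≡0
  ... | inj₂ (refl , refl) = contradiction (su , su′) outside

module _ {n} {G : Graph n} {T : ℕ} where

  record ExtraUnit (f g : TimedFlow G T) (u₀ : Fin n) (i₀ : ℕ) (v₀ : Fin n) : Set where
    field
      outflow-+ : ∀ w j → outflow g w j ≡ outflow f w j + δ u₀ i₀ w j
      inflow-+  : ∀ w j → inflow g w j ≡ inflow f w j + δ v₀ (suc i₀) w j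

  extraUnit-cross : ∀ {f g : TimedFlow G T} {i₀ u₀ v₀} →
    (∀ i u → stay g i u ≡ stay f i u) →
    (∀ i u v → cross g i u v ≡ cross f i u v + edgeδ i₀ u₀ v₀ i u v) →
    ExtraUnit f g u₀ i₀ v₀
  extraUnit-cross {f} {g} {i₀} {u₀} {v₀} stay≡ cross≡ = record { outflow-+ = out ; inflow-+ = in′ }
    where
    open ≡-Reasoning
    out : ∀ w j → outflow g w j ≡ outflow f w j + δ u₀ i₀ w j
    out w j = begin
      stay g j w + Σ[Fin] (cross g j w)
        ≡⟨ cong₂ _+_ (stay≡ j w) (Σ-cong (cross≡ j w)) ⟩
      stay f j w + Σ[Fin] (λ v → cross f j w v + edgeδ i₀ u₀ v₀ j w v)
        ≡⟨ cong (stay f j w +_) (Σ-distrib-+ (cross f j w) _) ⟩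
      stay f j w + (Σ[Fin] (cross f j w) + Σ[Fin] (edgeδ i₀ u₀ v₀ j w))
        ≡⟨ +-assoc (stay f j w) _ _ ⟨
      outflow f w j + Σ[Fin] (edgeδ i₀ u₀ v₀ j w)
        ≡⟨ cong (outflow f w j +_) (Σ-edgeδ-head i₀ u₀ v₀ j w) ⟩
      outflow f w j + δ u₀ i₀ w j ∎
    in′ : ∀ w j → inflow g w j ≡ inflow f w j + δ v₀ (suc i₀) w j
    in′ w zero    = sym (δ-off-time v₀ w {suc i₀} {0} λ ())
    in′ w (suc j) = begin
      stay g j w + Σ[Fin] (λ u → cross g j u w)
        ≡⟨ cong₂ _+_ (stay≡ j w) (Σ-cong (λ u → cross≡ j u w)) ⟩
      stay f j w + Σ[Fin] (λ u → cross f j u w + edgeδ i₀ u₀ v₀ j u w)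
        ≡⟨ cong (stay f j w +_) (Σ-distrib-+ (λ u → cross f j u w) _) ⟩
      stay f j w + (Σ[Fin] (λ u → cross f j u w) + Σ[Fin] (λ u → edgeδ i₀ u₀ v₀ j u w))
        ≡⟨ +-assoc (stay f j w) _ _ ⟨
      inflow f w (suc j) + Σ[Fin] (λ u → edgeδ i₀ u₀ v₀ j u w)
        ≡⟨ cong (inflow f w (suc j) +_) (Σ-edgeδ-tail i₀ u₀ v₀ j w) ⟩
      inflow f w (suc j) + δ v₀ (suc i₀) w (suc j) ∎

  extraUnit-stay : ∀ {f g : TimedFlow G T} {i₀ u₀} →
    (∀ i u → stay g i u ≡ stay f i u + δ u₀ i₀ u i) →
    (∀ i u v → cross g i u v ≡ cross f i u v) →
    ExtraUnit f g u₀ i₀ u₀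
  extraUnit-stay {f} {g} {i₀} {u₀} stay≡ cross≡ = record { outflow-+ = out ; inflow-+ = in′ }
    where
    out : ∀ w j → outflow g w j ≡ outflow f w j + δ u₀ i₀ w j
    out w j = trans (cong₂ _+_ (stay≡ j w) (Σ-cong (cross≡ j w))) (xy∙z≈xz∙y (stay f j w) _ _)
    in′ : ∀ w j → inflow g w j ≡ inflow f w j + δ u₀ (suc i₀) w j
    in′ w zero    = sym (δ-off-time u₀ w {suc i₀} {0} λ ())
    in′ w (suc j) = trans (cong₂ _+_ (stay≡ j w) (Σ-cong (λ u → cross≡ j u w))) (xy∙z≈xz∙y (stay f j w) _ _)

  addCross subCross : TimedFlow G T → ℕ → Fin n → Fin n → TimedFlow G T
  addCross f i₀ u₀ v₀ = record { cross = λ i u v → cross f i u v + edgeδ i₀ u₀ v₀ i u v ; stay = stay f }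
  subCross f i₀ u₀ v₀ = record { cross = λ i u v → cross f i u v ∸ edgeδ i₀ u₀ v₀ i u v ; stay = stay f }

  addStay subStay : TimedFlow G T → ℕ → Fin n → TimedFlow G T
  addStay f i₀ u₀ = record { cross = cross f ; stay = λ i u → stay f i u + δ u₀ i₀ u i }
  subStay f i₀ u₀ = record { cross = cross f ; stay = λ i u → stay f i u ∸ δ u₀ i₀ u i }

  extraUnit-addCross : ∀ f i₀ u₀ v₀ → ExtraUnit f (addCross f i₀ u₀ v₀) u₀ i₀ v₀
  extraUnit-addCross f i₀ u₀ v₀ = extraUnit-cross (λ _ _ → refl) (λ _ _ _ → refl)

  extraUnit-addStay : ∀ f i₀ u₀ → ExtraUnit f (addStay f i₀ u₀) u₀ i₀ u₀
  extraUnit-addStay f i₀ u₀ = extraUnit-stay (λ _ _ → refl) (λ _ _ _ → refl)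

  extraUnit-subCross : ∀ f i₀ u₀ v₀ → 1 ≤ cross f i₀ u₀ v₀ →
    ExtraUnit (subCross f i₀ u₀ v₀) f u₀ i₀ v₀
  extraUnit-subCross f i₀ u₀ v₀ pos = extraUnit-cross (λ _ _ → refl) (λ i u v → sym (m∸n+n≡m (edgeδ≤ i u v)))
    where
    edgeδ≤ : ∀ i u v → edgeδ i₀ u₀ v₀ i u v ≤ cross f i u v
    edgeδ≤ i u v with edgeδ-cases i₀ u₀ v₀ i u v
    ... | inj₁ edgeδ≡0 rewrite edgeδ≡0 = z≤n
    ... | inj₂ (refl , refl , refl) rewrite edgeδ-at i₀ u₀ v₀ = pos

  extraUnit-subStay : ∀ f i₀ u₀ → 1 ≤ stay f i₀ u₀ → ExtraUnit (subStay f i₀ u₀) f u₀ i₀ u₀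
  extraUnit-subStay f i₀ u₀ pos = extraUnit-stay (λ i u → sym (m∸n+n≡m (δ≤ i u))) (λ _ _ _ → refl)
    where
    δ≤ : ∀ i u → δ u₀ i₀ u i ≤ stay f i u
    δ≤ i u with δ-cases u₀ i₀ u i
    ... | inj₁ δ≡0 rewrite δ≡0 = z≤n
    ... | inj₂ (refl , refl) rewrite δ-at u₀ i₀ = pos

  record WithinCapacity (f : TimedFlow G T) : Set where
    field
      cap-unit    : ∀ i → i < T → ∀ u v → cross f i u v ≤ 1
      cap-nonedge : ∀ i → i < T → ∀ u v → adj G u v ≡ false → cross f i u v ≡ 0

  withinCapacity-addCross : ∀ f i₀ u₀ v₀ → adj G u₀ v₀ ≡ true → cross f i₀ u₀ v₀ ≡ 0 →
    WithinCapacity f → WithinCapacity (addCross f i₀ u₀ v₀)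
  withinCapacity-addCross f i₀ u₀ v₀ adj≡true unused cap = record { cap-unit = unit ; cap-nonedge = nonedge }
    where
    open WithinCapacity cap
    unit : ∀ i → i < T → ∀ u v → cross f i u v + edgeδ i₀ u₀ v₀ i u v ≤ 1
    unit i i<T u v with edgeδ-cases i₀ u₀ v₀ i u v
    ... | inj₁ edgeδ≡0 rewrite edgeδ≡0 | +-identityʳ (cross f i u v) = cap-unit i i<T u v
    ... | inj₂ (refl , refl , refl) rewrite unused | edgeδ-at i₀ u₀ v₀ = ≤-refl
    nonedge : ∀ i → i < T → ∀ u v → adj G u v ≡ false → cross f i u v + edgeδ i₀ u₀ v₀ i u v ≡ 0
    nonedge i i<T u v adj≡false with edgeδ-cases i₀ u₀ v₀ i u v
    ... | inj₁ edgeδ≡0 rewrite edgeδ≡0 | +-identityʳ (cross f i u v) = cap-nonedge i i<T u v adj≡false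
    ... | inj₂ (refl , refl , refl) with trans (sym adj≡true) adj≡false
    ... | ()

  withinCapacity-subCross : ∀ f i₀ u₀ v₀ → WithinCapacity f → WithinCapacity (subCross f i₀ u₀ v₀)
  withinCapacity-subCross f i₀ u₀ v₀ cap = record
    { cap-unit    = λ i i<T u v → ≤-trans (m∸n≤m _ (edgeδ i₀ u₀ v₀ i u v)) (cap-unit i i<T u v)
    ; cap-nonedge = λ i i<T u v adj≡false →
        trans (cong (_∸ edgeδ i₀ u₀ v₀ i u v) (cap-nonedge i i<T u v adj≡false)) (0∸n≡0 (edgeδ i₀ u₀ v₀ i u v))
    }
    where open WithinCapacity cap

  module _ (a b : Fin n) (k : ℕ) where

    -- The augmenting walk moves the extra unit source (x,t) from the sink (b,T), where f is a
    -- flow of value k, back along residual edges to (a,0), where f is a flow of value k + 1.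
    record DeficitAt (f : TimedFlow G T) (x : Fin n) (t : ℕ) : Set where
      field
        conserve   : ∀ j → j < T → ∀ w → (j ≡ 0 → w ≢ a) → inflow f w j + δ x t w j ≡ outflow f w j
        conserve-T : ∀ w → w ≢ b → inflow f w T + δ x t w T ≡ 0
        value      : outflow f a 0 ≡ k + δ x t a 0

    deficit-to-tail : ∀ {f g u i v} → ExtraUnit f g u i v → i < T →
      DeficitAt f v (suc i) → DeficitAt g u i
    deficit-to-tail {f} {g} {u} {i} {v} extra i<T def = record
      { conserve = conserve′ ; conserve-T = conserve-T′ ; value = value′ }
      where
      open ExtraUnit extra
      open DeficitAt def
      open ≡-Reasoning
      conserve′ : ∀ j → j < T → ∀ w → (j ≡ 0 → w ≢ a) → inflow g w j + δ u i w j ≡ outflow g w j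
      conserve′ j j<T w notSource = begin
        inflow g w j + δ u i w j                    ≡⟨ cong (_+ δ u i w j) (inflow-+ w j) ⟩
        inflow f w j + δ v (suc i) w j + δ u i w j  ≡⟨ cong (_+ δ u i w j) (conserve j j<T w notSource) ⟩
        outflow f w j + δ u i w j                   ≡⟨ outflow-+ w j ⟨
        outflow g w j                               ∎
      conserve-T′ : ∀ w → w ≢ b → inflow g w T + δ u i w T ≡ 0
      conserve-T′ w w≢b = begin
        inflow g w T + δ u i w T                    ≡⟨ cong₂ _+_ (inflow-+ w T) (δ-off-time u w (>⇒≢ i<T)) ⟩
        inflow f w T + δ v (suc i) w T + 0          ≡⟨ +-identityʳ _ ⟩
        inflow f w T + δ v (suc i) w T              ≡⟨ conserve-T w w≢b ⟩
        0                                           ∎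
      value′ : outflow g a 0 ≡ k + δ u i a 0
      value′ = begin
        outflow g a 0
          ≡⟨ outflow-+ a 0 ⟩
        outflow f a 0 + δ u i a 0
          ≡⟨ cong (_+ δ u i a 0) value ⟩
        k + δ v (suc i) a 0 + δ u i a 0
          ≡⟨ cong (λ z → k + z + δ u i a 0) (δ-off-time v a {suc i} {0} λ ()) ⟩
        k + 0 + δ u i a 0
          ≡⟨ cong (_+ δ u i a 0) (+-identityʳ k) ⟩
        k + δ u i a 0 ∎

    deficit-to-head : ∀ {f g u i v} → ExtraUnit g f u i v →
      DeficitAt f u i → DeficitAt g v (suc i)
    deficit-to-head {f} {g} {u} {i} {v} extra def = record
      { conserve = conserve′ ; conserve-T = conserve-T′ ; value = value′ }
      where
      open ExtraUnit extra
      open DeficitAt def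
      open ≡-Reasoning
      conserve′ : ∀ j → j < T → ∀ w → (j ≡ 0 → w ≢ a) → inflow g w j + δ v (suc i) w j ≡ outflow g w j
      conserve′ j j<T w notSource = +-cancelʳ-≡ _ _ _ (begin
        inflow g w j + δ v (suc i) w j + δ u i w j  ≡⟨ cong (_+ δ u i w j) (inflow-+ w j) ⟨
        inflow f w j + δ u i w j                    ≡⟨ conserve j j<T w notSource ⟩
        outflow f w j                               ≡⟨ outflow-+ w j ⟩
        outflow g w j + δ u i w j                   ∎)
      conserve-T′ : ∀ w → w ≢ b → inflow g w T + δ v (suc i) w T ≡ 0
      conserve-T′ w w≢b = m+n≡0⇒m≡0 _ (trans (cong (_+ δ u i w T) (sym (inflow-+ w T))) (conserve-T w w≢b))
      value′ : outflow g a 0 ≡ k + δ v (suc i) a 0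
      value′ = begin
        outflow g a 0                               ≡⟨ +-cancelʳ-≡ _ _ _ (trans (sym (outflow-+ a 0)) value) ⟩
        k                                           ≡⟨ +-identityʳ k ⟨
        k + 0                                       ≡⟨ cong (k +_) (δ-off-time v a {suc i} {0} λ ()) ⟨
        k + δ v (suc i) a 0                         ∎

    withinCapacity : ∀ {f} → IsFlow G T a b k f → WithinCapacity f
    withinCapacity fl = record { cap-unit = cap-unit ; cap-nonedge = cap-nonedge }
      where open IsFlow fl

    deficitAt-sink : ∀ {f} → 1 ≤ T → IsFlow G T a b k f → DeficitAt f b T
    deficitAt-sink {f} T≥1 fl = record
      { conserve   = λ j j<T w notSource →
          trans (cong (inflow f w j +_) (δ-off-time b w (<⇒≢ j<T))) (trans (+-identityʳ _) (conserve j j<T w notSource))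
      ; conserve-T = λ w w≢b →
          cong₂ _+_ (conserve-T w w≢b) (δ-off-vertex T T w≢b)
      ; value      = trans value (sym (trans (cong (k +_) (δ-off-time b a (<⇒≢ T≥1))) (+-identityʳ k)))
      }
      where open IsFlow fl

    isFlow-deficitAt-source : ∀ {f} → 1 ≤ T → WithinCapacity f → DeficitAt f a 0 → IsFlow G T a b (suc k) f
    isFlow-deficitAt-source {f} T≥1 cap def = record
      { cap-unit    = cap-unit
      ; cap-nonedge = cap-nonedge
      ; conserve    = λ j j<T w notSource →
          trans (sym (trans (cong (inflow f w j +_) (δ-off j w notSource)) (+-identityʳ _))) (conserve j j<T w notSource)
      ; conserve-T  = λ w w≢b →
          trans (sym (trans (cong (inflow f w T +_) (δ-off-time a w (>⇒≢ T≥1))) (+-identityʳ _))) (conserve-T w w≢b)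
      ; value       = trans value (trans (cong (k +_) (δ-at a 0)) (+-comm k 1))
      }
      where
      open WithinCapacity cap
      open DeficitAt def
      δ-off : ∀ j w → (j ≡ 0 → w ≢ a) → δ a 0 w j ≡ 0
      δ-off zero    w notSource = δ-off-vertex 0 0 (notSource refl)
      δ-off (suc j) w _         = δ-off-time a w {0} {suc j} λ ()

module Residual {n} (G : Graph n) (T : ℕ) (a : Fin n) (f : TimedFlow G T) where

  anyVertex : (Fin n → Bool) → Bool
  anyVertex p = ⌊ Finₚ.any? (λ u → T? (p u)) ⌋

  anyVertex-sound : ∀ {p} → So (anyVertex p) → ∃ λ u → So (p u)
  anyVertex-sound {p} = toWitness {a? = Finₚ.any? (λ u → T? (p u))}

  anyVertex-complete : ∀ {p} u → So (p u) → So (anyVertex p)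
  anyVertex-complete {p} u pu = fromWitness {a? = Finₚ.any? (λ u → T? (p u))} (u , pu)

  data ResidualFrom (S : Fin n → ℕ → Bool) : Fin n → ℕ → Set where
    forward-cross  : ∀ {i u v} → i < T → So (S u i) → adj G u v ≡ true → cross f i u v ≡ 0 →
                     ResidualFrom S v (suc i)
    forward-stay   : ∀ {i u} → i < T → So (S u i) → ResidualFrom S u (suc i)
    backward-cross : ∀ {i u v} → i < T → So (S v (suc i)) → 1 ≤ cross f i u v → ResidualFrom S u i
    backward-stay  : ∀ {i u} → i < T → So (S u (suc i)) → 1 ≤ stay f i u → ResidualFrom S u i

  forward? backward? residualFrom? : (Fin n → ℕ → Bool) → Fin n → ℕ → Bool
  forward? S v zero    = false
  forward? S v (suc i) = (i <ᵇ T) ∧ (anyVertex (λ u → S u i ∧ adj G u v ∧ (cross f i u v ≡ᵇ 0)) ∨ S v i)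
  backward? S u i = (i <ᵇ T) ∧ (anyVertex (λ v → S v (suc i) ∧ (0 <ᵇ cross f i u v)) ∨ (S u (suc i) ∧ (0 <ᵇ stay f i u)))
  residualFrom? S w j = forward? S w j ∨ backward? S w j

  module _ {S : Fin n → ℕ → Bool} where

    residualFrom?-sound : ∀ {w j} → So (residualFrom? S w j) → ResidualFrom S w j
    residualFrom?-sound {w} {j} r with to T-∨ r
    ... | inj₁ fwd = forward-sound w j fwd
      where
      forward-sound : ∀ v i → So (forward? S v i) → ResidualFrom S v i
      forward-sound v (suc i) r with to T-∧ r
      ... | i<ᵇT , r′ with to T-∨ r′
      ... | inj₂ Svi = forward-stay (<ᵇ⇒< i T i<ᵇT) Svi
      ... | inj₁ some with anyVertex-sound some
      ... | u , e with to T-∧ e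
      ... | Sui , e′ with to T-∧ e′
      ... | isAdj , unused = forward-cross (<ᵇ⇒< i T i<ᵇT) Sui (to T-≡ isAdj) (≡ᵇ⇒≡ _ 0 unused)
    ... | inj₂ bwd with to T-∧ bwd
    ... | j<ᵇT , r′ with to T-∨ r′
    ... | inj₂ e with to T-∧ e
    ... | Swj , pos = backward-stay (<ᵇ⇒< j T j<ᵇT) Swj (<ᵇ⇒< 0 _ pos)
    residualFrom?-sound {w} {j} r | inj₂ bwd | j<ᵇT , r′ | inj₁ some with anyVertex-sound some
    ... | v , e with to T-∧ e
    ... | Sv , pos = backward-cross (<ᵇ⇒< j T j<ᵇT) Sv (<ᵇ⇒< 0 _ pos)

    residualFrom?-complete : ∀ {w j} → ResidualFrom S w j → So (residualFrom? S w j)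
    residualFrom?-complete (forward-cross {u = u} i<T Sui isAdj unused) =
      from T-∨ (inj₁ (from T-∧ (<⇒<ᵇ i<T , from T-∨ (inj₁ (anyVertex-complete u
        (from T-∧ (Sui , from T-∧ (from T-≡ isAdj , ≡⇒≡ᵇ _ 0 unused))))))))
    residualFrom?-complete (forward-stay i<T Sui) =
      from T-∨ (inj₁ (from T-∧ (<⇒<ᵇ i<T , from T-∨ (inj₂ Sui))))
    residualFrom?-complete (backward-cross {v = v} i<T Sv pos) =
      from T-∨ (inj₂ (from T-∧ (<⇒<ᵇ i<T , from T-∨ (inj₁ (anyVertex-complete v (from T-∧ (Sv , <⇒<ᵇ pos)))))))
    residualFrom?-complete (backward-stay i<T Su pos) =
      from T-∨ (inj₂ (from T-∧ (<⇒<ᵇ i<T , from T-∨ (inj₂ (from T-∧ (Su , <⇒<ᵇ pos))))))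

  Closed : (Fin n → ℕ → Bool) → Set
  Closed S = ∀ {w j} → ResidualFrom S w j → So (S w j)

  reach : ℕ → Fin n → ℕ → Bool
  reach zero    w j = ⌊ w Finₚ.≟ a ⌋ ∧ ⌊ j ≟ 0 ⌋
  reach (suc m) w j = reach m w j ∨ residualFrom? (reach m) w j

  reach-mono : ∀ m {w j} → So (reach m w j) → So (reach (suc m) w j)
  reach-mono m r = from T-∨ (inj₁ r)

  reach-source : ∀ m → So (reach m a 0)
  reach-source zero    = from T-∧ (fromWitness {a? = a Finₚ.≟ a} refl , _)
  reach-source (suc m) = reach-mono m (reach-source m)

  reach-zero : ∀ {w j} → So (reach 0 w j) → w ≡ a × j ≡ 0
  reach-zero {w} {j} r with to T-∧ r
  ... | w≡a , j≡0 = toWitness {a? = w Finₚ.≟ a} w≡a , toWitness {a? = j ≟ 0} j≡0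

  reach-residual : ∀ m {w j} → ResidualFrom (reach m) w j → So (reach (suc m) w j)
  reach-residual m {w} {j} e = from (T-∨ {reach m w j}) (inj₂ (residualFrom?-complete e))

  reach-new : ∀ m {w j} → So (reach (suc m) w j) → ¬ So (reach m w j) → ResidualFrom (reach m) w j
  reach-new m {w} {j} r old with to (T-∨ {reach m w j}) r
  ... | inj₁ r′ = contradiction r′ old
  ... | inj₂ e  = residualFrom?-sound e

  reach-≤T : ∀ m {w j} → So (reach m w j) → j ≤ T
  reach-≤T zero {w} {j} r with reach-zero {w} {j} r
  ... | _ , refl = z≤n
  reach-≤T (suc m) {w} {j} r with T? (reach m w j)
  ... | yes old = reach-≤T m old
  ... | no  new with reach-new m r new
  ... | forward-cross  i<T _ _ _ = i<T
  ... | forward-stay   i<T _     = i<T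
  ... | backward-cross i<T _ _   = <⇒≤ i<T
  ... | backward-stay  i<T _ _   = <⇒≤ i<T

  reach-beyond : ∀ m w {j} → ¬ j ≤ T → reach m w j ≡ false
  reach-beyond m w j≰T = ¬So⇒≡false (j≰T ∘ reach-≤T m)

  reach-closed : ∃ λ M → Closed (reach M)
  reach-closed with stabilises (λ m w (j : Fin (suc T)) → reach m w (toℕ j)) (λ m _ _ → reach-mono m)
  ... | M , stable = M , λ {w} {j} e → subst So (stable′ w j) (reach-residual M e)
    where
    stable′ : ∀ w j → reach (suc M) w j ≡ reach M w j
    stable′ w j with j ≤? T
    ... | yes j≤T = subst (λ i → reach (suc M) w i ≡ reach M w i) (Finₚ.toℕ-fromℕ< (s≤s j≤T)) (stable w (fromℕ< (s≤s j≤T)))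
    ... | no  j≰T = trans (reach-beyond (suc M) w j≰T) (sym (reach-beyond M w j≰T))

module Augmentation {n} {G : Graph n} {T : ℕ} {a b : Fin n} {k : ℕ} {f : TimedFlow G T}
                    (T≥1 : 1 ≤ T) (fl : IsFlow G T a b k f) where

  open Residual G T a f

  record Agrees (h : TimedFlow G T) (m : ℕ) : Set where
    field
      cross-agrees : ∀ i u v → So (reach m u i) → So (reach m v (suc i)) → cross h i u v ≡ cross f i u v
      stay-agrees  : ∀ i u → So (reach m u i) → So (reach m u (suc i)) → stay h i u ≡ stay f i u
  open Agrees

  agrees-modified : ∀ {h h′ m} → Agrees h (suc m) →
    (∀ i u v → So (reach m u i) → So (reach m v (suc i)) → cross h′ i u v ≡ cross h i u v) →
    (∀ i u → So (reach m u i) → So (reach m u (suc i)) → stay h′ i u ≡ stay h i u) →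
    Agrees h′ m
  agrees-modified {m = m} ag cross≡ stay≡ = record
    { cross-agrees = λ i u v ru rv →
        trans (cross≡ i u v ru rv) (cross-agrees ag i u v (reach-mono m ru) (reach-mono m rv))
    ; stay-agrees  = λ i u ru ru′ →
        trans (stay≡ i u ru ru′) (stay-agrees ag i u (reach-mono m ru) (reach-mono m ru′))
    }

  agrees-addCross : ∀ {h m i u y} → Agrees h (suc m) → ¬ So (reach m y (suc i)) → Agrees (addCross h i u y) m
  agrees-addCross {h} {m} ag y∉ = agrees-modified ag
    (λ i′ u′ v′ ru rv → trans (cong (cross h i′ u′ v′ +_) (edgeδ-outside (reach m) (y∉ ∘ proj₂) i′ u′ v′ ru rv)) (+-identityʳ _))
    (λ _ _ _ _ → refl)

  agrees-addStay : ∀ {h m i y} → Agrees h (suc m) → ¬ So (reach m y (suc i)) → Agrees (addStay h i y) m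
  agrees-addStay {h} {m} ag y∉ = agrees-modified ag
    (λ _ _ _ _ _ → refl)
    (λ i′ u′ ru ru′ → trans (cong (stay h i′ u′ +_) (δ-outside (reach m) (y∉ ∘ proj₂) i′ u′ ru ru′)) (+-identityʳ _))

  agrees-subCross : ∀ {h m t y v} → Agrees h (suc m) → ¬ So (reach m y t) → Agrees (subCross h t y v) m
  agrees-subCross {h} {m} ag y∉ = agrees-modified ag
    (λ i′ u′ v′ ru rv → cong (cross h i′ u′ v′ ∸_) (edgeδ-outside (reach m) (y∉ ∘ proj₁) i′ u′ v′ ru rv))
    (λ _ _ _ _ → refl)

  agrees-subStay : ∀ {h m t y} → Agrees h (suc m) → ¬ So (reach m y t) → Agrees (subStay h t y) m
  agrees-subStay {h} {m} ag y∉ = agrees-modified ag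
    (λ _ _ _ _ _ → refl)
    (λ i′ u′ ru ru′ → cong (stay h i′ u′ ∸_) (δ-outside (reach m) (y∉ ∘ proj₁) i′ u′ ru ru′))

  Augmented : Set
  Augmented = Σ (TimedFlow G T) λ h → WithinCapacity h × DeficitAt a b k h a 0

  -- The walk descends strictly through the levels of reach, so every modified edge has an
  -- endpoint outside reach m: h still agrees with f there, and the residual edges of f used
  -- further down are residual edges of h too.
  walk : ∀ m {y t} (h : TimedFlow G T) → So (reach m y t) → Agrees h m →
    WithinCapacity h → DeficitAt a b k h y t → Augmented
  walk zero {y} {t} h r _ cap def with reach-zero {y} {t} r
  ... | refl , refl = h , cap , def
  walk (suc m) {y} {t} h r ag cap def with T? (reach m y t)
  ... | yes old = walk m h old (agrees-modified ag (λ _ _ _ _ _ → refl) (λ _ _ _ _ → refl)) cap def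
  ... | no  new with reach-new m r new
  ... | forward-cross {i} {u} i<T ru isAdj unused =
    walk m (addCross h i u y) ru (agrees-addCross ag new)
      (withinCapacity-addCross h i u y isAdj (trans (cross-agrees ag i u y (reach-mono m ru) r) unused) cap)
      (deficit-to-tail a b k (extraUnit-addCross h i u y) i<T def)
  ... | forward-stay {i} i<T ry =
    walk m (addStay h i y) ry (agrees-addStay ag new) (record { WithinCapacity cap })
      (deficit-to-tail a b k (extraUnit-addStay h i y) i<T def)
  ... | backward-cross {v = v} _ rv pos =
    walk m (subCross h t y v) rv (agrees-subCross ag new) (withinCapacity-subCross h t y v cap)
      (deficit-to-head a b k (extraUnit-subCross h t y v (subst (1 ≤_) (sym (cross-agrees ag t y v r (reach-mono m rv))) pos)) def)
  ... | backward-stay _ ry pos =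
    walk m (subStay h t y) ry (agrees-subStay ag new) (record { WithinCapacity cap })
      (deficit-to-head a b k (extraUnit-subStay h t y (subst (1 ≤_) (sym (stay-agrees ag t y r (reach-mono m ry))) pos)) def)

  augment : ∀ m → So (reach m b T) → CanSend G a b (suc k) T
  augment m r with walk m f r (record { cross-agrees = λ _ _ _ _ _ → refl ; stay-agrees = λ _ _ _ _ → refl })
                             (withinCapacity a b k fl) (deficitAt-sink a b k T≥1 fl)
  ... | h , cap , def = h , isFlow-deficitAt-source a b k T≥1 cap def

module Cut {n} {G : Graph n} {T : ℕ} {a b : Fin n} {k : ℕ} {f : TimedFlow G T}
           (T≥1 : 1 ≤ T) (fl : IsFlow G T a b k f) (S : Fin n → ℕ → Bool)
           (closed : Residual.Closed G T a f S) (S-source : So (S a 0)) (S-sink : ¬ So (S b T)) where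

  open Residual G T a f using (ResidualFrom; forward-cross; forward-stay; backward-cross; backward-stay)
  open IsFlow fl

  S-up : ∀ {w i} j → So (S w i) → i ≤ j → j ≤ T → So (S w j)
  S-up {w} {i} j Si i≤j j≤T with i ≟ j
  ... | yes refl = Si
  S-up zero    Si i≤j j≤T | no i≢j = contradiction (n≤0⇒n≡0 i≤j) i≢j
  S-up (suc j) Si i≤j j≤T | no i≢j =
    closed (forward-stay j≤T (S-up j Si (m<1+n⇒m≤n (≤∧≢⇒< i≤j i≢j)) (<⇒≤ j≤T)))

  ℓ : Fin n → ℕ
  ℓ w = first (suc T) (S w)

  ℓ-≤ : ∀ w → ℓ w ≤ suc T
  ℓ-≤ w = first-≤ (suc T) (S w)

  ℓ-≤-S : ∀ {w j} → So (S w j) → ℓ w ≤ j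
  ℓ-≤-S {w} {j} Sj with ℓ w ≤? j
  ... | yes ℓ≤j = ℓ≤j
  ... | no  ℓ≰j = contradiction Sj (first-minimal (suc T) (S w) (≰⇒> ℓ≰j))

  S-≥-ℓ : ∀ {w j} → ℓ w ≤ j → j ≤ T → So (S w j)
  S-≥-ℓ {w} {j} ℓ≤j j≤T = S-up j (first-found (suc T) (S w) (s≤s (≤-trans ℓ≤j j≤T))) ℓ≤j j≤T

  S≡ℓ≤ᵇ : ∀ w j → j ≤ T → S w j ≡ (ℓ w ≤ᵇ j)
  S≡ℓ≤ᵇ w j j≤T with ℓ w ≤ᵇ j | ≤ᵇ-reflects-≤ (ℓ w) j
  ... | true  | ofʸ ℓ≤j = to T-≡ (S-≥-ℓ ℓ≤j j≤T)
  ... | false | ofⁿ ℓ≰j = ¬So⇒≡false (ℓ≰j ∘ ℓ-≤-S)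

  ℓ-source : ℓ a ≡ 0
  ℓ-source = n≤0⇒n≡0 (ℓ-≤-S S-source)

  ℓ-sink : ℓ b ≡ suc T
  ℓ-sink = ≤-antisym (ℓ-≤ b) (≰⇒> λ ℓ≤T → S-sink (S-≥-ℓ ℓ≤T ≤-refl))

  -- Closure of S under residual edges: no flow enters S from outside, and every unit edge
  -- leaving S is saturated.
  stay-across : ∀ u j → j < T → when (S u j) (stay f j u) ≡ when (S u (suc j)) (stay f j u)
  stay-across u j j<T with S u j in Sj | S u (suc j) in Sj′
  ... | true  | true  = refl
  ... | false | false = refl
  ... | true  | false = ⊥-elim (≡false⇒¬So Sj′ (closed (forward-stay j<T (from T-≡ Sj))))
  ... | false | true  with stay f j u in stay≡
  ...   | zero  = refl
  ...   | suc _ = ⊥-elim (≡false⇒¬So Sj (closed (backward-stay j<T (from T-≡ Sj′) (subst (1 ≤_) (sym stay≡) z<s))))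

  cutEdge : ℕ → Fin n → Fin n → ℕ
  cutEdge j u v = when (S u j) (if S v (suc j) then 0 else (if adj G u v then 1 else 0))

  cross-across : ∀ u v j → j < T →
    when (S u j) (cross f j u v) ≡ when (S v (suc j)) (cross f j u v) + cutEdge j u v
  cross-across u v j j<T with S u j in Sj | S v (suc j) in Sj′
  ... | true  | true  = sym (+-identityʳ _)
  ... | false | false = refl
  ... | false | true  with cross f j u v in cross≡
  ...   | zero  = refl
  ...   | suc _ = ⊥-elim (≡false⇒¬So Sj (closed (backward-cross j<T (from T-≡ Sj′) (subst (1 ≤_) (sym cross≡) z<s))))
  cross-across u v j j<T | true | false with adj G u v in isAdj
  ... | false = cap-nonedge j j<T u v isAdj
  ... | true  with cross f j u v in cross≡
  ...   | zero  = ⊥-elim (≡false⇒¬So Sj′ (closed (forward-cross j<T (from T-≡ Sj) isAdj cross≡)))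
  ...   | suc c = cong suc (n≤0⇒n≡0 (s≤s⁻¹ (subst (_≤ 1) cross≡ (cap-unit j j<T u v))))

  outOfS intoS boundary : ℕ → ℕ
  outOfS j   = Σ[Fin] (λ w → when (S w j) (outflow f w j))
  intoS j    = Σ[Fin] (λ w → when (S w j) (inflow f w j))
  boundary j = Σ[Fin] (λ u → Σ[Fin] (cutEdge j u))

  outOfS-step : ∀ j → j < T → outOfS j ≡ intoS (suc j) + boundary j
  outOfS-step j j<T = begin
    Σ[Fin] (λ u → when (S u j) (stay f j u + Σ[Fin] (cross f j u)))
      ≡⟨ Σ-cong (λ u → when-+-Σ (S u j) (stay f j u) (cross f j u)) ⟩
    Σ[Fin] (λ u → when (S u j) (stay f j u) + Σ[Fin] (λ v → when (S u j) (cross f j u v)))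
      ≡⟨ Σ-cong (λ u → cong₂ _+_ (stay-across u j j<T) (Σ-cong (λ v → cross-across u v j j<T))) ⟩
    Σ[Fin] (λ u → when (S u (suc j)) (stay f j u) + Σ[Fin] (λ v → when (S v (suc j)) (cross f j u v) + cutEdge j u v))
      ≡⟨ Σ-distrib-+ {n} _ _ ⟩
    stays + Σ[Fin] (λ u → Σ[Fin] (λ v → when (S v (suc j)) (cross f j u v) + cutEdge j u v))
      ≡⟨ cong (stays +_) (trans (Σ-cong (λ u → Σ-distrib-+ {n} _ (cutEdge j u))) (Σ-distrib-+ {n} _ _)) ⟩
    stays + (Σ[Fin] (λ u → Σ[Fin] (λ v → when (S v (suc j)) (cross f j u v))) + boundary j)
      ≡⟨ cong (λ z → stays + (z + boundary j)) (Σ-comm (λ u v → when (S v (suc j)) (cross f j u v))) ⟩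
    stays + (crosses + boundary j)
      ≡⟨ +-assoc stays crosses (boundary j) ⟨
    stays + crosses + boundary j
      ≡⟨ cong (_+ boundary j) (Σ-distrib-+ {n} _ _) ⟨
    Σ[Fin] (λ v → when (S v (suc j)) (stay f j v) + Σ[Fin] (λ u → when (S v (suc j)) (cross f j u v))) + boundary j
      ≡⟨ cong (_+ boundary j) (Σ-cong (λ v → when-+-Σ (S v (suc j)) (stay f j v) (λ u → cross f j u v))) ⟨
    intoS (suc j) + boundary j ∎
    where
    open ≡-Reasoning
    stays crosses : ℕ
    stays   = Σ[Fin] (λ v → when (S v (suc j)) (stay f j v))
    crosses = Σ[Fin] (λ v → Σ[Fin] (λ u → when (S v (suc j)) (cross f j u v)))

  intoS-conserve : ∀ j → suc j < T → intoS (suc j) ≡ outOfS (suc j)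
  intoS-conserve j sj<T = Σ-cong (λ w → cong (when (S w (suc j))) (conserve (suc j) sj<T w λ ()))

  outOfS-source : outOfS 0 ≡ k
  outOfS-source = begin
    outOfS 0                       ≡⟨ Σ-point _ a off-source ⟩
    when (S a 0) (outflow f a 0)   ≡⟨ cong (λ s → when s (outflow f a 0)) (to T-≡ S-source) ⟩
    outflow f a 0                  ≡⟨ value ⟩
    k                              ∎
    where
    open ≡-Reasoning
    off-source : ∀ w → w ≢ a → when (S w 0) (outflow f w 0) ≡ 0
    off-source w w≢a = trans (cong (when (S w 0)) (sym (conserve 0 T≥1 w (λ _ → w≢a)))) (when-0 (S w 0))

  intoS-sink : intoS T ≡ 0
  intoS-sink = Σ-zero into
    where
    into : ∀ w → when (S w T) (inflow f w T) ≡ 0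
    into w with w Finₚ.≟ b
    ... | yes refl rewrite ¬So⇒≡false S-sink = refl
    ... | no  w≢b  = trans (cong (when (S w T)) (conserve-T w w≢b)) (when-0 (S w T))

  potential : ℕ → ℕ
  potential zero    = outOfS 0
  potential (suc j) = intoS (suc j)

  potential-step : ∀ j → j < T → potential j ≡ potential (suc j) + boundary j
  potential-step zero    0<T  = outOfS-step 0 0<T
  potential-step (suc j) sj<T = trans (intoS-conserve j sj<T) (outOfS-step (suc j) sj<T)

  potential-end : ∀ t → 1 ≤ t → potential t ≡ intoS t
  potential-end (suc t) _ = refl

  value≡Σboundary : k ≡ Σ[Fin] {T} (boundary ∘ toℕ)
  value≡Σboundary = begin
    k
      ≡⟨ outOfS-source ⟨
    potential 0
      ≡⟨ telescope T potential boundary potential-step ⟩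
    potential T + Σ[Fin] {T} (boundary ∘ toℕ)
      ≡⟨ cong (_+ Σ[Fin] {T} (boundary ∘ toℕ)) (trans (potential-end T T≥1) intoS-sink) ⟩
    Σ[Fin] {T} (boundary ∘ toℕ) ∎
    where open ≡-Reasoning

  cutEdge-window : ∀ u v (j : Fin T) → cutEdge (toℕ j) u v ≡ when (adj G u v) (window (ℓ u) (ℓ v) (toℕ j))
  cutEdge-window u v j
    rewrite S≡ℓ≤ᵇ u (toℕ j) (<⇒≤ (Finₚ.toℕ<n j)) | S≡ℓ≤ᵇ v (suc (toℕ j)) (Finₚ.toℕ<n j)
    with adj G u v
  ... | true  = refl
  ... | false with ℓ u ≤ᵇ toℕ j | ℓ v ≤ᵇ suc (toℕ j)
  ...   | true  | true  = refl
  ...   | true  | false = refl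
  ...   | false | _     = refl

  Σ-cutEdge : ∀ u v → Σ[Fin] {T} (λ j → cutEdge (toℕ j) u v) ≡ when (adj G u v) (ℓ v ∸ 1 ∸ ℓ u)
  Σ-cutEdge u v = begin
    Σ[Fin] {T} (λ j → cutEdge (toℕ j) u v)
      ≡⟨ Σ-cong (cutEdge-window u v) ⟩
    Σ[Fin] {T} (λ j → when (adj G u v) (window (ℓ u) (ℓ v) (toℕ j)))
      ≡⟨ Σ-when {T} (adj G u v) (window (ℓ u) (ℓ v) ∘ toℕ) ⟩
    when (adj G u v) (Σ[Fin] {T} (window (ℓ u) (ℓ v) ∘ toℕ))
      ≡⟨ cong (when (adj G u v)) (Σ-window T (ℓ u) (ℓ v) (ℓ-≤ v)) ⟩
    when (adj G u v) (ℓ v ∸ 1 ∸ ℓ u) ∎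
    where open ≡-Reasoning

  edgeCost-≤-value : edgeCost G ℓ ≤ k
  edgeCost-≤-value = begin
    edgeCost G ℓ
      ≤⟨ ΣΣ-unordered-≤ _ slack edge-split ⟩
    Σ[Fin] (λ u → Σ[Fin] (slack u))
      ≡⟨ Σ-cong (λ u → Σ-cong (λ v → Σ-cutEdge u v)) ⟨
    Σ[Fin] (λ u → Σ[Fin] (λ v → Σ[Fin] {T} (λ j → cutEdge (toℕ j) u v)))
      ≡⟨ Σ-cong (λ u → Σ-comm {n} {T} (λ v j → cutEdge (toℕ j) u v)) ⟩
    Σ[Fin] (λ u → Σ[Fin] {T} (λ j → Σ[Fin] (cutEdge (toℕ j) u)))
      ≡⟨ Σ-comm {n} {T} (λ u j → Σ[Fin] (cutEdge (toℕ j) u)) ⟩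
    Σ[Fin] {T} (boundary ∘ toℕ)
      ≡⟨ value≡Σboundary ⟨
    k ∎
    where
    open ≤-Reasoning
    slack : Fin n → Fin n → ℕ
    slack u v = when (adj G u v) (ℓ v ∸ 1 ∸ ℓ u)
    edge-split : ∀ u v → (if adj G u v ∧ (toℕ u <ᵇ toℕ v) then ∣ ℓ u - ℓ v ∣ ∸ 1 else 0) ≤
                         when (toℕ u <ᵇ toℕ v) (slack u v + slack v u)
    edge-split u v with adj G u v in isAdj | toℕ u <ᵇ toℕ v
    ... | false | _     = z≤n
    ... | true  | false = z≤n
    ... | true  | true  rewrite trans (Graph.sym G v u) isAdj = ≤-reflexive (∣-∣∸1-split (ℓ u) (ℓ v))

module _ {n} (G : Graph n) (a b : Fin n) (T : ℕ) where

  Levels : (ℕ → Set) → Set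
  Levels Bound = Σ (Fin n → ℕ) λ ℓ → (∀ u → ℓ u ≤ suc T) × ℓ a ≡ 0 × ℓ b ≡ suc T × Bound (edgeCost G ℓ)

  zeroFlow : CanSend G a b 0 T
  zeroFlow = flow , record
    { cap-unit    = λ _ _ _ _ → z≤n
    ; cap-nonedge = λ _ _ _ _ _ → refl
    ; conserve    = λ j _ w _ → trans (no-inflow w j) (sym (no-outflow w j))
    ; conserve-T  = λ w _ → no-inflow w T
    ; value       = no-outflow a 0
    }
    where
    flow : TimedFlow G T
    flow = record { cross = λ _ _ _ → 0 ; stay = λ _ _ → 0 }
    no-outflow : ∀ w j → outflow flow w j ≡ 0
    no-outflow w j = Σ-zero {n} (λ _ → refl)
    no-inflow : ∀ w j → inflow flow w j ≡ 0
    no-inflow w zero    = refl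
    no-inflow w (suc j) = Σ-zero {n} (λ _ → refl)

  augment-or-cut : ∀ {k} → 1 ≤ T → CanSend G a b k T → CanSend G a b (suc k) T ⊎ Levels (_≤ k)
  augment-or-cut T≥1 (f , fl) with Residual.reach-closed G T a f
  ... | M , closed with T? (Residual.reach G T a f M b T)
  ... | yes sink-reached = inj₁ (Augmentation.augment T≥1 fl M sink-reached)
  ... | no  sink-cut     = inj₂ (ℓ , ℓ-≤ , ℓ-source , ℓ-sink , edgeCost-≤-value)
    where open Cut T≥1 fl (Residual.reach G T a f M) closed (Residual.reach-source G T a f M) sink-cut

  levels-below : ∀ {N} → 1 ≤ T → ¬ CanSend G a b N T → ∀ d {k} → d + k ≡ N → CanSend G a b k T →
    Levels (_< N)
  levels-below T≥1 cannot zero    refl flow = contradiction flow cannot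
  levels-below T≥1 cannot (suc d) {k} d+k≡N flow with augment-or-cut T≥1 flow
  ... | inj₁ flow′ = levels-below T≥1 cannot d (trans (+-suc d k) d+k≡N) flow′
  ... | inj₂ (ℓ , ℓ-≤ , ℓ-source , ℓ-sink , cost≤k) =
    ℓ , ℓ-≤ , ℓ-source , ℓ-sink , ≤-<-trans cost≤k (subst (k <_) d+k≡N (m<n+m k z<s))

lemma3p1 : ∀ {n} (G : Graph n) (a b : Fin n) (N T : ℕ) → 1 ≤ N → 1 ≤ T →
    ¬ CanSend G a b N T →
    Σ (Fin n → ℕ) (λ ℓ → (∀ u → ℓ u ≤ suc T) × ℓ a ≡ 0 × ℓ b ≡ suc T × edgeCost G ℓ < N)
lemma3p1 G a b N T _ T≥1 cannot = levels-below G a b T T≥1 cannot N (+-identityʳ N) (zeroFlow G a b T)
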